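{- Let $m,b\in\mathbb{N}$ with $m\leq b$, and let $\mathcal{H}=(X,\mathcal{F})$ be a hypergraph together with a collection $\mathcal{V}$ of pairwise disjoint subsets of $X$ such that: (1) $|F|>m$ for all $F\in\mathcal{F}$; (2) $|V|=m$ for all $V\in\mathcal{V}$; (3) for any $V\in\mathcal{V}$ and $F\in\mathcal{F}$, $V\subseteq F$ or $V\cap F=\varnothing$; (4) each $x\in X\setminus\bigcup_{V\in\mathcal{V}}V$ lies in at most one hyperedge of $\mathcal{F}$. If Maker has a winning strategy in the $(m:b)$ Maker-Breaker game on $\mathcal{H}$, then she also has a winning strategy in this game in which, in each of her moves, she either claims all vertices of some set $V\in\mathcal{V}$, or claims all remaining vertices of a winning set $F\in\mathcal{F}$ and thereby immediately wins.
   Context: In the $(m:b)$ Maker-Breaker game on $\mathcal{H}=(X,\mathcal{F})$, Maker and Breaker alternate, Maker claiming up to $m$ and Breaker up to $b$ unclaimed elements of $X$ per move; Maker wins by claiming all elements of some hyperedge (winning set) $F\in\mathcal{F}$, Breaker wins otherwise. -}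

module Defs where

open import Data.Nat using (ℕ; _≤_; _<_)
open import Data.Product using (Σ; _×_; ∃-syntax)
open import Data.Sum using (_⊎_)
open import Data.List using (List)
open import Data.Fin using (Fin)
open import Data.Fin.Subset using (Subset; _∪_; _∩_; _─_; _⊆_; _∈_; _∉_; ∣_∣; Empty; ⊥)
open import Relation.Binary.PropositionalEquality using (_≡_; _≢_)
import Data.List.Membership.Propositional as L

-- Ground set X = Fin n; hypergraph family and 𝒱 are lists of subsets,
-- interpreted as collections (membership = L._∈_).

Disjoint : ∀ {n} → Subset n → Subset n → Set
Disjoint A B = Empty (A ∩ B)

MakerHolds : ∀ {n} → List (Subset n) → Subset n → Set
MakerHolds ℱ M = ∃[ F ] (F L.∈ ℱ × F ⊆ M)

-- Maker-Breaker (m:b) game: positions (M , B) = elements claimed by Maker / Breaker,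
-- Maker to move. MakerWins ℱ m b M B : Maker has a winning strategy from (M , B)
-- (least fixed point: Maker must win after finitely many rounds; infinite play /
-- a full board without a Maker set is a Breaker win).
data MakerWins {n : ℕ} (ℱ : List (Subset n)) (m b : ℕ) : Subset n → Subset n → Set where
  move : ∀ {M B} (A : Subset n) → Disjoint A (M ∪ B) → ∣ A ∣ ≤ m →
         (MakerHolds ℱ (M ∪ A) ⊎
          ((R : Subset n) → Disjoint R ((M ∪ A) ∪ B) → ∣ R ∣ ≤ b →
             MakerWins ℱ m b (M ∪ A) (B ∪ R))) →
         MakerWins ℱ m b M B

data MakerWinsVia {n : ℕ} (ℱ 𝒱 : List (Subset n)) (m b : ℕ) : Subset n → Subset n → Set where
  claimV : ∀ {M B} (V : Subset n) → V L.∈ 𝒱 → Disjoint V (M ∪ B) →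
           ((R : Subset n) → Disjoint R ((M ∪ V) ∪ B) → ∣ R ∣ ≤ b →
              MakerWinsVia ℱ 𝒱 m b (M ∪ V) (B ∪ R)) →
           MakerWinsVia ℱ 𝒱 m b M B
  finish : ∀ {M B} (F : Subset n) → F L.∈ ℱ → Disjoint F B → ∣ F ─ M ∣ ≤ m →
           MakerWinsVia ℱ 𝒱 m b M B

record Assumptions {n : ℕ} (m : ℕ) (ℱ 𝒱 : List (Subset n)) : Set where
  field
    pairwiseDisjoint : ∀ V W → V L.∈ 𝒱 → W L.∈ 𝒱 → V ≢ W → Disjoint V W
    edgeSize   : ∀ F → F L.∈ ℱ → m < ∣ F ∣
    partSize   : ∀ V → V L.∈ 𝒱 → ∣ V ∣ ≡ m
    insideOrDisjoint : ∀ V F → V L.∈ 𝒱 → F L.∈ ℱ → V ⊆ F ⊎ Disjoint V F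
    outsideDegree : ∀ (x : Fin n) → (∀ V → V L.∈ 𝒱 → x ∉ V) →
                    ∀ F G → F L.∈ ℱ → G L.∈ ℱ → x ∈ F → x ∈ G → F ≡ G

module Submission where

-- Maker plays an imagined copy of the game against the given winning strategy
-- and keeps her real vertices a union of parts, all claimed in the imagined
-- game too.  If the strategy's move A completes a winning set, she completes it
-- for real.  If A contains a part V then A = V (as |A| ≤ m = |V|) and she copies
-- it; the real Breaker's answer is passed on to the imagined game.  Otherwise
-- she does not move at all, and lets the imagined Breaker answer A himself with
-- at most one free vertex per x ∈ A, chosen so that every winning set through x
-- meets his vertices; one vertex suffices by (3) when x lies in a part and by
-- (4) when it does not, and |A| ≤ m ≤ b.  So every imagined Maker vertex that
-- is not real is blocked in the imagined game, and an imagined win is completed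
-- by the real Maker within a single move.

import Data.Bool as Bool
open import Data.Empty using (⊥-elim)
open import Data.Fin using (Fin; zero; suc)
open import Data.Fin.Subset
open import Data.Fin.Subset.Properties
open import Data.List using (List)
import Data.List.Membership.Propositional as L
open import Data.List.Membership.Propositional using (find; lose)
open import Data.List.Relation.Unary.Any using (any?)
open import Data.Nat using (ℕ; _≤_; _+_; z≤n; s≤s)
open import Data.Nat.Properties using (≤-trans; ≤-reflexive; +-suc; m≤n⇒m≤1+n; +-mono-≤; <⇒≱)
open import Data.Product using (_×_; _,_; ∃-syntax)
open import Data.Sum using (_⊎_; inj₁; inj₂; [_,_]′)
open import Data.Vec using ([]; _∷_; here; there)
open import Data.Vec.Properties using (≡-dec)
open import Function using (_∘_)
open import Relation.Binary.PropositionalEquality using (_≡_; sym; subst)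
open import Relation.Nullary using (¬_; yes; no; contradiction)
open import Relation.Nullary.Decidable using (decidable-stable)
open import Relation.Unary using (Decidable)

open import Defs

private variable
  k n : ℕ
  p q r s : Subset n
  x y : Fin n

x∈p─q⇒x∉q : ∀ (p q : Subset n) → x ∈ p ─ q → x ∉ q
x∈p─q⇒x∉q (_ ∷ p) (outside ∷ q) here          ()
x∈p─q⇒x∉q (_ ∷ p) (outside ∷ q) (there x∈p─q) (there x∈q) = x∈p─q⇒x∉q p q x∈p─q x∈q
x∈p─q⇒x∉q (_ ∷ p) (inside  ∷ q) (there x∈p─q) (there x∈q) = x∈p─q⇒x∉q p q x∈p─q x∈q

p⊆q∪r⇒p─q⊆r : ∀ (p q r : Subset n) → p ⊆ q ∪ r → p ─ q ⊆ r
p⊆q∪r⇒p─q⊆r p q r p⊆q∪r x∈p─q with x∈p∪q⁻ q r (p⊆q∪r (p─q⊆p p q x∈p─q))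
... | inj₁ x∈q = contradiction x∈q (x∈p─q⇒x∉q p q x∈p─q)
... | inj₂ x∈r = x∈r

∣p∪q∣≤∣p∣+∣q∣ : ∀ (p q : Subset n) → ∣ p ∪ q ∣ ≤ ∣ p ∣ + ∣ q ∣
∣p∪q∣≤∣p∣+∣q∣ []            []            = z≤n
∣p∪q∣≤∣p∣+∣q∣ (outside ∷ p) (outside ∷ q) = ∣p∪q∣≤∣p∣+∣q∣ p q
∣p∪q∣≤∣p∣+∣q∣ (outside ∷ p) (inside  ∷ q) rewrite +-suc ∣ p ∣ ∣ q ∣ = s≤s (∣p∪q∣≤∣p∣+∣q∣ p q)
∣p∪q∣≤∣p∣+∣q∣ (inside  ∷ p) (outside ∷ q) = s≤s (∣p∪q∣≤∣p∣+∣q∣ p q)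
∣p∪q∣≤∣p∣+∣q∣ (inside  ∷ p) (inside  ∷ q) rewrite +-suc ∣ p ∣ ∣ q ∣ =
  s≤s (m≤n⇒m≤1+n (∣p∪q∣≤∣p∣+∣q∣ p q))

p⊆q⊎Nonempty[p─q] : ∀ (p q : Subset n) → p ⊆ q ⊎ Nonempty (p ─ q)
p⊆q⊎Nonempty[p─q] p q with nonempty? (p ─ q)
... | yes witness = inj₂ witness
... | no  empty   = inj₁ λ {x} x∈p →
  decidable-stable (x ∈? q) (λ x∉q → empty (x , x∈p∧x∉q⇒x∈p─q x∈p x∉q))

p⊆q∧∣q∣≤∣p∣⇒q⊆p : p ⊆ q → ∣ q ∣ ≤ ∣ p ∣ → q ⊆ p
p⊆q∧∣q∣≤∣p∣⇒q⊆p {p = p} {q = q} p⊆q ∣q∣≤∣p∣ with p⊆q⊎Nonempty[p─q] q p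
... | inj₁ q⊆p = q⊆p
... | inj₂ (x , x∈q─p) =
  contradiction ∣q∣≤∣p∣ (<⇒≱ (p⊂q⇒∣p∣<∣q∣ (p⊆q , x , p─q⊆p q p x∈q─p , x∈p─q⇒x∉q q p x∈q─p)))

Disjoint⁺ : (∀ {x} → x ∈ p → x ∉ q) → Disjoint p q
Disjoint⁺ {p = p} {q = q} separate (x , x∈p∩q) =
  let x∈p , x∈q = x∈p∩q⁻ p q x∈p∩q in separate x∈p x∈q

Disjoint⁻ : Disjoint p q → x ∈ p → x ∉ q
Disjoint⁻ p∩q≡∅ x∈p x∈q = p∩q≡∅ (_ , x∈p∩q⁺ (x∈p , x∈q))

Disjoint-⊥ : Disjoint ⊥ p
Disjoint-⊥ = Disjoint⁺ λ x∈⊥ _ → ∉⊥ x∈⊥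

Disjoint-sym : Disjoint p q → Disjoint q p
Disjoint-sym p∩q≡∅ = Disjoint⁺ λ x∈q x∈p → Disjoint⁻ p∩q≡∅ x∈p x∈q

Disjoint-mono : p ⊆ r → q ⊆ s → Disjoint r s → Disjoint p q
Disjoint-mono p⊆r q⊆s r∩s≡∅ = Disjoint⁺ λ x∈p x∈q → Disjoint⁻ r∩s≡∅ (p⊆r x∈p) (q⊆s x∈q)

Disjoint-∪ˡ : Disjoint p r → Disjoint q r → Disjoint (p ∪ q) r
Disjoint-∪ˡ {p = p} {q = q} p∩r≡∅ q∩r≡∅ = Disjoint⁺ λ x∈p∪q →
  [ Disjoint⁻ p∩r≡∅ , Disjoint⁻ q∩r≡∅ ]′ (x∈p∪q⁻ p q x∈p∪q)

Disjoint-∪ʳ : Disjoint p q → Disjoint p r → Disjoint p (q ∪ r)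
Disjoint-∪ʳ p∩q≡∅ p∩r≡∅ = Disjoint-sym (Disjoint-∪ˡ (Disjoint-sym p∩q≡∅) (Disjoint-sym p∩r≡∅))

Disjoint[p─q,q] : ∀ (p q : Subset n) → Disjoint (p ─ q) q
Disjoint[p─q,q] p q = Disjoint⁺ (x∈p─q⇒x∉q p q)

∪-least : p ⊆ r → q ⊆ r → p ∪ q ⊆ r
∪-least {p = p} {q = q} p⊆r q⊆r x∈p∪q = [ p⊆r , q⊆r ]′ (x∈p∪q⁻ p q x∈p∪q)

∪-mono : p ⊆ r → q ⊆ s → p ∪ q ⊆ r ∪ s
∪-mono {r = r} {s = s} p⊆r q⊆s = ∪-least (p⊆p∪q s ∘ p⊆r) (q⊆p∪q r s ∘ q⊆s)

x∉p∪q⁺ : x ∉ p → x ∉ q → x ∉ p ∪ q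
x∉p∪q⁺ {p = p} {q = q} x∉p x∉q x∈p∪q = [ x∉p , x∉q ]′ (x∈p∪q⁻ p q x∈p∪q)

p⊆[p─q]∪q : ∀ (p q : Subset n) → p ⊆ (p ─ q) ∪ q
p⊆[p─q]∪q p q {x} x∈p with x ∈? q
... | yes x∈q = q⊆p∪q (p ─ q) q x∈q
... | no  x∉q = p⊆p∪q q (x∈p∧x∉q⇒x∈p─q x∈p x∉q)

⋃[_]_ : Subset k → (Fin k → Subset n) → Subset n
⋃[ []          ] g = ⊥
⋃[ inside  ∷ a ] g = g zero ∪ ⋃[ a ] (g ∘ suc)
⋃[ outside ∷ a ] g = ⋃[ a ] (g ∘ suc)

⊆⋃[] : ∀ (a : Subset k) (g : Fin k → Subset n) {i} → i ∈ a → g i ⊆ ⋃[ a ] g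
⊆⋃[] (inside  ∷ a) g here        = p⊆p∪q _
⊆⋃[] (inside  ∷ a) g (there i∈a) = q⊆p∪q _ _ ∘ ⊆⋃[] a (g ∘ suc) i∈a
⊆⋃[] (outside ∷ a) g (there i∈a) = ⊆⋃[] a (g ∘ suc) i∈a

∈⋃[]⁻ : ∀ (a : Subset k) (g : Fin k → Subset n) → x ∈ ⋃[ a ] g → ∃[ i ] (i ∈ a × x ∈ g i)
∈⋃[]⁻ []            g x∈⋃ = contradiction x∈⋃ ∉⊥
∈⋃[]⁻ (inside  ∷ a) g x∈⋃ with x∈p∪q⁻ (g zero) (⋃[ a ] (g ∘ suc)) x∈⋃
... | inj₁ x∈g0 = zero , here , x∈g0
... | inj₂ x∈⋃′ = let i , i∈a , x∈gi = ∈⋃[]⁻ a (g ∘ suc) x∈⋃′ in suc i , there i∈a , x∈gi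
∈⋃[]⁻ (outside ∷ a) g x∈⋃ = let i , i∈a , x∈gi = ∈⋃[]⁻ a (g ∘ suc) x∈⋃ in suc i , there i∈a , x∈gi

∣⋃[]∣≤∣a∣ : ∀ (a : Subset k) (g : Fin k → Subset n) →
            (∀ {i} → i ∈ a → ∣ g i ∣ ≤ 1) → ∣ ⋃[ a ] g ∣ ≤ ∣ a ∣
∣⋃[]∣≤∣a∣ {n = n} [] g _ = ≤-reflexive (∣⊥∣≡0 n)
∣⋃[]∣≤∣a∣ (inside ∷ a) g small = ≤-trans (∣p∪q∣≤∣p∣+∣q∣ (g zero) _)
  (+-mono-≤ (small here) (∣⋃[]∣≤∣a∣ a (g ∘ suc) (small ∘ there)))
∣⋃[]∣≤∣a∣ (outside ∷ a) g small = ∣⋃[]∣≤∣a∣ a (g ∘ suc) (small ∘ there)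

find-or-none : ∀ {A : Set} {P : A → Set} → Decidable P → (xs : List A) →
               ∃[ x ] (x L.∈ xs × P x) ⊎ (∀ {x} → x L.∈ xs → ¬ P x)
find-or-none P? xs with any? P? xs
... | yes some = inj₁ (find some)
... | no  none = inj₂ λ x∈xs Px → none (lose x∈xs Px)

module Simulation {n m b : ℕ} (m≤b : m ≤ b) {ℱ 𝒱 : List (Subset n)} (H : Assumptions m ℱ 𝒱) where
  open Assumptions H

  Blocked : Subset n → Fin n → Set
  Blocked C x = ∀ {F} → F L.∈ ℱ → x ∈ F → Nonempty (F ∩ C)

  EdgesThrough_Contain_ : Fin n → Fin n → Set
  EdgesThrough x Contain y = ∀ {F} → F L.∈ ℱ → x ∈ F → y ∈ F

  Blocked-mono : p ⊆ q → Blocked p x → Blocked q x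
  Blocked-mono p⊆q blocked F∈ℱ x∈F =
    let y , y∈F∩p = blocked F∈ℱ x∈F
        y∈F , y∈p = x∈p∩q⁻ _ _ y∈F∩p
    in y , x∈p∩q⁺ (y∈F , p⊆q y∈p)

  Blocked-by : EdgesThrough x Contain y → y ∈ p → Blocked p x
  Blocked-by x⇒y y∈p F∈ℱ x∈F = _ , x∈p∩q⁺ (x⇒y F∈ℱ x∈F , y∈p)

  Blocked-transfer : EdgesThrough x Contain y → Blocked p y → Blocked p x
  Blocked-transfer x⇒y blocked F∈ℱ x∈F = blocked F∈ℱ (x⇒y F∈ℱ x∈F)

  edgesThroughPart : ∀ {V} → V L.∈ 𝒱 → x ∈ V → y ∈ V → EdgesThrough x Contain y
  edgesThroughPart {V = V} V∈𝒱 x∈V y∈V {F} F∈ℱ x∈F with insideOrDisjoint V F V∈𝒱 F∈ℱ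
  ... | inj₁ V⊆F = V⊆F y∈V
  ... | inj₂ V∩F≡∅ = contradiction x∈F (Disjoint⁻ V∩F≡∅ x∈V)

  edgesThroughOutsider : (∀ {V} → V L.∈ 𝒱 → x ∉ V) →
                         ∀ {F} → F L.∈ ℱ → x ∈ F → y ∈ F → EdgesThrough x Contain y
  edgesThroughOutsider {x = x} x∉⋃𝒱 {F} F∈ℱ x∈F y∈F {G} G∈ℱ x∈G =
    subst (_ ∈_) (outsideDegree x (λ _ → x∉⋃𝒱) F G F∈ℱ G∈ℱ x∈F x∈G) y∈F

  PartClosed : Subset n → Set
  PartClosed C = ∀ {V} → V L.∈ 𝒱 → Nonempty (V ∩ C) → V ⊆ C

  PartClosed-⊥ : PartClosed ⊥
  PartClosed-⊥ _ (_ , x∈V∩⊥) = contradiction (p∩q⊆q _ _ x∈V∩⊥) ∉⊥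

  parts-meet⇒≡ : ∀ {V W} → V L.∈ 𝒱 → W L.∈ 𝒱 → Nonempty (V ∩ W) → V ≡ W
  parts-meet⇒≡ {V} {W} V∈𝒱 W∈𝒱 V∩W≢∅ =
    decidable-stable (≡-dec Bool._≟_ V W) λ V≢W → pairwiseDisjoint V W V∈𝒱 W∈𝒱 V≢W V∩W≢∅

  PartClosed-∪ : ∀ {C V} → PartClosed C → V L.∈ 𝒱 → PartClosed (C ∪ V)
  PartClosed-∪ {C} {V} closed V∈𝒱 {W} W∈𝒱 (x , x∈W∩[C∪V])
    with x∈p∩q⁻ W (C ∪ V) x∈W∩[C∪V]
  ... | x∈W , x∈C∪V with x∈p∪q⁻ C V x∈C∪V
  ...   | inj₁ x∈C = p⊆p∪q V ∘ closed W∈𝒱 (x , x∈p∩q⁺ (x∈W , x∈C))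
  ...   | inj₂ x∈V rewrite parts-meet⇒≡ W∈𝒱 V∈𝒱 (x , x∈p∩q⁺ (x∈W , x∈V)) = q⊆p∪q C V

  -- (M , B) is the position of the imagined game, played with the given
  -- strategy; (M′ , B′) is the position of the real game.
  record Tracks (M B M′ B′ : Subset n) : Set where
    field
      maker⊆            : M′ ⊆ M
      breaker⊆          : B′ ⊆ M ∪ B
      imagined-disjoint : Disjoint M B
      real-disjoint     : Disjoint M′ B′
      real-closed       : PartClosed M′
      surplus-blocked   : ∀ {z} → z ∈ M → z ∉ M′ → Blocked B z

  tracks-start : Tracks ⊥ ⊥ ⊥ ⊥
  tracks-start = record
    { maker⊆            = ⊆-refl
    ; breaker⊆          = λ x∈⊥ → contradiction x∈⊥ ∉⊥
    ; imagined-disjoint = Disjoint-⊥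
    ; real-disjoint     = Disjoint-⊥
    ; real-closed       = PartClosed-⊥
    ; surplus-blocked   = λ z∈⊥ → contradiction z∈⊥ ∉⊥
    }

  module ImaginedMove {M B M′ B′ A : Subset n} (tracks : Tracks M B M′ B′)
                      (A-free : Disjoint A (M ∪ B)) (∣A∣≤m : ∣ A ∣ ≤ m) where
    open Tracks tracks

    Occupied : Subset n
    Occupied = (M ∪ A) ∪ B

    M∪A-disjoint-B : Disjoint (M ∪ A) B
    M∪A-disjoint-B = Disjoint-∪ˡ imagined-disjoint (Disjoint-mono ⊆-refl (q⊆p∪q M B) A-free)

    A-free-in-real : Disjoint A (M′ ∪ B′)
    A-free-in-real = Disjoint-mono ⊆-refl (∪-least (p⊆p∪q B ∘ maker⊆) breaker⊆) A-free

    finishCompletion : ∀ {F} → F L.∈ ℱ → F ⊆ M ∪ A → MakerWinsVia ℱ 𝒱 m b M′ B′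
    finishCompletion {F} F∈ℱ F⊆M∪A =
      finish F F∈ℱ F-free (≤-trans (p⊆q⇒∣p∣≤∣q∣ (p⊆q∪r⇒p─q⊆r F M′ A F⊆M′∪A)) ∣A∣≤m)
      where
      F∩B≡∅ : Disjoint F B
      F∩B≡∅ = Disjoint-mono F⊆M∪A ⊆-refl M∪A-disjoint-B

      F⊆M′∪A : F ⊆ M′ ∪ A
      F⊆M′∪A {x} x∈F with x∈p∪q⁻ M A (F⊆M∪A x∈F)
      ... | inj₂ x∈A = q⊆p∪q M′ A x∈A
      ... | inj₁ x∈M with x ∈? M′
      ...   | yes x∈M′ = p⊆p∪q A x∈M′
      ...   | no  x∉M′ = contradiction (surplus-blocked x∈M x∉M′ F∈ℱ x∈F) F∩B≡∅

      F-free : Disjoint F B′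
      F-free = Disjoint-mono F⊆M′∪A ⊆-refl
        (Disjoint-∪ˡ real-disjoint (Disjoint-mono ⊆-refl (q⊆p∪q M′ B′) A-free-in-real))

    tracks-part : A L.∈ 𝒱 → ∀ {R} → Disjoint R ((M′ ∪ A) ∪ B′) →
                  Tracks (M ∪ A) (B ∪ (R ─ Occupied)) (M′ ∪ A) (B′ ∪ R)
    tracks-part A∈𝒱 {R} R-free = record
      { maker⊆            = ∪-mono maker⊆ ⊆-refl
      ; breaker⊆          = ∪-least
          (⊆-trans breaker⊆ (∪-mono (p⊆p∪q A) (p⊆p∪q _)))
          (⊆-trans (p⊆[p─q]∪q R Occupied)
                   (∪-least (q⊆p∪q _ _ ∘ q⊆p∪q B _) (∪-mono ⊆-refl (p⊆p∪q _))))
      ; imagined-disjoint = Disjoint-∪ʳ M∪A-disjoint-B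
          (Disjoint-sym (Disjoint-mono ⊆-refl (p⊆p∪q B) (Disjoint[p─q,q] R Occupied)))
      ; real-disjoint     = Disjoint-∪ʳ
          (Disjoint-∪ˡ real-disjoint (Disjoint-mono ⊆-refl (q⊆p∪q M′ B′) A-free-in-real))
          (Disjoint-sym (Disjoint-mono ⊆-refl (p⊆p∪q B′) R-free))
      ; real-closed       = PartClosed-∪ real-closed A∈𝒱
      ; surplus-blocked   = surplus
      }
      where
      surplus : ∀ {z} → z ∈ M ∪ A → z ∉ M′ ∪ A → Blocked (B ∪ (R ─ Occupied)) z
      surplus {z} z∈M∪A z∉M′∪A with x∈p∪q⁻ M A z∈M∪A
      ... | inj₁ z∈M = Blocked-mono (p⊆p∪q _) (surplus-blocked z∈M (z∉M′∪A ∘ p⊆p∪q A))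
      ... | inj₂ z∈A = contradiction (q⊆p∪q M′ A z∈A) z∉M′∪A

    module _ (noCompletion : ∀ {F} → F L.∈ ℱ → F ⊈ M ∪ A)
             (noPart : ∀ {V} → V L.∈ 𝒱 → V ⊈ A) where

      record Blocker (x : Fin n) : Set where
        field
          answer      : Subset n
          answer-free : Disjoint answer Occupied
          ∣answer∣≤1  : ∣ answer ∣ ≤ 1
          blocks      : x ∈ A → Blocked (B ∪ answer) x

      noAnswer : (x ∈ A → Blocked B x) → Blocker x
      noAnswer blocked = record
        { answer      = ⊥
        ; answer-free = Disjoint-⊥
        ; ∣answer∣≤1  = ≤-trans (≤-reflexive (∣⊥∣≡0 n)) z≤n
        ; blocks      = Blocked-mono (p⊆p∪q ⊥) ∘ blocked
        }

      singleAnswer : y ∉ Occupied → EdgesThrough x Contain y → Blocker x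
      singleAnswer {y} y∉Occupied x⇒y = record
        { answer      = ⁅ y ⁆
        ; answer-free = Disjoint⁺ λ w∈⁅y⁆ →
            subst (_∉ Occupied) (sym (x∈⁅y⁆⇒x≡y y w∈⁅y⁆)) y∉Occupied
        ; ∣answer∣≤1  = ≤-reflexive (∣⁅x⁆∣≡1 y)
        ; blocks      = λ _ → Blocked-by x⇒y (q⊆p∪q B ⁅ y ⁆ (x∈⁅x⁆ y))
        }

      answerThrough : EdgesThrough x Contain y → y ∉ A → y ∉ M′ → Blocker x
      answerThrough {y = y} x⇒y y∉A y∉M′ with y ∈? B | y ∈? M
      ... | yes y∈B | _       = noAnswer λ _ → Blocked-by x⇒y y∈B
      ... | no _    | yes y∈M = noAnswer λ _ → Blocked-transfer x⇒y (surplus-blocked y∈M y∉M′)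
      ... | no y∉B  | no y∉M  = singleAnswer (x∉p∪q⁺ (x∉p∪q⁺ y∉M y∉A) y∉B) x⇒y

      partBlocker : x ∈ A → ∀ {V} → V L.∈ 𝒱 → x ∈ V → Blocker x
      partBlocker x∈A {V} V∈𝒱 x∈V with p⊆q⊎Nonempty[p─q] V A
      ... | inj₁ V⊆A = ⊥-elim (noPart V∈𝒱 V⊆A)
      ... | inj₂ (y , y∈V─A) =
        answerThrough (edgesThroughPart V∈𝒱 x∈V y∈V) (x∈p─q⇒x∉q V A y∈V─A) y∉M′
        where
        y∈V = p─q⊆p V A y∈V─A
        y∉M′ : y ∉ M′
        y∉M′ y∈M′ = Disjoint⁻ A-free x∈A
          (p⊆p∪q B (maker⊆ (real-closed V∈𝒱 (y , x∈p∩q⁺ (y∈V , y∈M′)) x∈V)))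

      outsiderBlocker : (∀ {V} → V L.∈ 𝒱 → x ∉ V) → ∀ {F} → F L.∈ ℱ → x ∈ F → Blocker x
      outsiderBlocker x∉⋃𝒱 {F} F∈ℱ x∈F with p⊆q⊎Nonempty[p─q] F (M ∪ A)
      ... | inj₁ F⊆M∪A = ⊥-elim (noCompletion F∈ℱ F⊆M∪A)
      ... | inj₂ (y , y∈F─M∪A) =
        answerThrough (edgesThroughOutsider x∉⋃𝒱 F∈ℱ x∈F (p─q⊆p F (M ∪ A) y∈F─M∪A))
                      (y∉M∪A ∘ q⊆p∪q M A) (y∉M∪A ∘ p⊆p∪q A ∘ maker⊆)
        where y∉M∪A = x∈p─q⇒x∉q F (M ∪ A) y∈F─M∪A

      blocker : ∀ x → Blocker x
      blocker x with x ∈? A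
      ... | no x∉A = noAnswer λ x∈A → contradiction x∈A x∉A
      ... | yes x∈A with find-or-none (x ∈?_) 𝒱
      ...   | inj₁ (_ , V∈𝒱 , x∈V) = partBlocker x∈A V∈𝒱 x∈V
      ...   | inj₂ x∉⋃𝒱 with find-or-none (x ∈?_) ℱ
      ...     | inj₁ (_ , F∈ℱ , x∈F) = outsiderBlocker x∉⋃𝒱 F∈ℱ x∈F
      ...     | inj₂ x∉⋃ℱ = noAnswer λ _ F∈ℱ x∈F → contradiction x∈F (x∉⋃ℱ F∈ℱ)

      blockingAnswer : Subset n
      blockingAnswer = ⋃[ A ] (Blocker.answer ∘ blocker)

      blockingAnswer-free : Disjoint blockingAnswer Occupied
      blockingAnswer-free = Disjoint⁺ λ y∈K →
        let x , _ , y∈answer = ∈⋃[]⁻ A _ y∈K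
        in Disjoint⁻ (Blocker.answer-free (blocker x)) y∈answer

      ∣blockingAnswer∣≤b : ∣ blockingAnswer ∣ ≤ b
      ∣blockingAnswer∣≤b = ≤-trans (∣⋃[]∣≤∣a∣ A _ (λ {x} _ → Blocker.∣answer∣≤1 (blocker x)))
                                   (≤-trans ∣A∣≤m m≤b)

      tracks-blocking : Tracks (M ∪ A) (B ∪ blockingAnswer) M′ B′
      tracks-blocking = record
        { maker⊆            = p⊆p∪q A ∘ maker⊆
        ; breaker⊆          = ⊆-trans breaker⊆ (∪-mono (p⊆p∪q A) (p⊆p∪q _))
        ; imagined-disjoint = Disjoint-∪ʳ M∪A-disjoint-B
            (Disjoint-sym (Disjoint-mono ⊆-refl (p⊆p∪q B) blockingAnswer-free))
        ; real-disjoint     = real-disjoint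
        ; real-closed       = real-closed
        ; surplus-blocked   = surplus
        }
        where
        surplus : ∀ {z} → z ∈ M ∪ A → z ∉ M′ → Blocked (B ∪ blockingAnswer) z
        surplus {z} z∈M∪A z∉M′ with x∈p∪q⁻ M A z∈M∪A
        ... | inj₁ z∈M = Blocked-mono (p⊆p∪q _) (surplus-blocked z∈M z∉M′)
        ... | inj₂ z∈A =
          Blocked-mono (∪-mono ⊆-refl (⊆⋃[] A _ z∈A)) (Blocker.blocks (blocker z) z∈A)

    replyIsPart : ∀ {V} → V L.∈ 𝒱 → V ⊆ A → A L.∈ 𝒱
    replyIsPart {V} V∈𝒱 V⊆A = subst (L._∈ 𝒱) (⊆-antisym V⊆A A⊆V) V∈𝒱
      where A⊆V = p⊆q∧∣q∣≤∣p∣⇒q⊆p V⊆A (≤-trans ∣A∣≤m (≤-reflexive (sym (partSize V V∈𝒱))))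

    Continuation : Set
    Continuation = ∀ R → Disjoint R Occupied → ∣ R ∣ ≤ b →
                   ∀ {M″ B″} → Tracks (M ∪ A) (B ∪ R) M″ B″ → MakerWinsVia ℱ 𝒱 m b M″ B″

    copyPart : A L.∈ 𝒱 → Continuation → MakerWinsVia ℱ 𝒱 m b M′ B′
    copyPart A∈𝒱 continue = claimV A A∈𝒱 A-free-in-real λ R R-free ∣R∣≤b →
      continue (R ─ Occupied) (Disjoint[p─q,q] R Occupied) (≤-trans (∣p─q∣≤∣p∣ R Occupied) ∣R∣≤b)
               (tracks-part A∈𝒱 R-free)

    followStrategy : Continuation → MakerWinsVia ℱ 𝒱 m b M′ B′
    followStrategy continue with find-or-none (λ F → F ⊆? M ∪ A) ℱ
    ... | inj₁ (_ , F∈ℱ , F⊆M∪A) = finishCompletion F∈ℱ F⊆M∪A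
    ... | inj₂ noCompletion with find-or-none (_⊆? A) 𝒱
    ...   | inj₁ (_ , V∈𝒱 , V⊆A) = copyPart (replyIsPart V∈𝒱 V⊆A) continue
    ...   | inj₂ noPart = continue _ (blockingAnswer-free noCompletion noPart)
                                   (∣blockingAnswer∣≤b noCompletion noPart)
                                   (tracks-blocking noCompletion noPart)

  simulate : ∀ {M B M′ B′} → MakerWins ℱ m b M B → Tracks M B M′ B′ → MakerWinsVia ℱ 𝒱 m b M′ B′
  simulate (move A A-free ∣A∣≤m (inj₁ (_ , F∈ℱ , F⊆M∪A))) tracks =
    ImaginedMove.finishCompletion tracks A-free ∣A∣≤m F∈ℱ F⊆M∪A
  simulate (move A A-free ∣A∣≤m (inj₂ next)) tracks =
    ImaginedMove.followStrategy tracks A-free ∣A∣≤m λ R R-free ∣R∣≤b →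
      simulate (next R R-free ∣R∣≤b)

proposition3p8 : (n m b : ℕ) → m ≤ b → (ℱ 𝒱 : List (Subset n)) →
    Assumptions m ℱ 𝒱 → MakerWins ℱ m b ⊥ ⊥ → MakerWinsVia ℱ 𝒱 m b ⊥ ⊥
proposition3p8 n m b m≤b ℱ 𝒱 H makerWins = simulate makerWins tracks-start
  where open Simulation m≤b H
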